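{- For any position $P$ of the Maker-Maker domination game and any odd positive integer $n$, $o(P\cup[Bo^nB],B)=\mathcal{D}$ (the bounded path being on a vertex set disjoint from that of $P$).
   Context: Maker-Maker domination game: on a finite simple graph $G$, Alice and Bob alternately claim previously unclaimed vertices; the first player whose claimed vertices form a dominating set of $G$ wins; if all vertices are claimed and nobody dominates, it is a draw. A position is $P=(G,V_A,V_B)$ with $V_A\cap V_B=\emptyset$ the vertices already claimed by Alice and Bob. For $t\in\{A,B\}$, $o(P,t)=\mathcal{A}$ if, with player $t$ to move from $P$, Alice has a strategy guaranteeing that her claimed vertices (including $V_A$) dominate $G$ before Bob's (including $V_B$) do; otherwise $o(P,t)=\mathcal{D}$. The union of positions on disjoint vertex sets is the componentwise union of graphs and claimed sets. For $X,Y\in\{A,B\}$ and $n\ge 0$, the bounded path $[Xo^nY]$ is the position on the path $v_{ -1}v_0v_1\cdots v_nv_{n+1}v_{n+2}$ in which exactly $v_1,\dots,v_n$ are unclaimed, $v_0$ is claimed by player $X$ and $v_{ -1}$ by the other player, and $v_{n+1}$ is claimed by player $Y$ and $v_{n+2}$ by the other player. -}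

module Defs where

open import Data.Bool using (Bool; true; false; _∨_; if_then_else_)
open import Data.Bool.Properties using (∨-comm)
open import Data.Nat using (ℕ; zero; suc; _+_; _≡ᵇ_)
open import Data.Fin using (Fin; toℕ; splitAt; _≟_)
open import Data.Sum using (_⊎_; inj₁; inj₂)
open import Data.Product using (Σ; _×_; _,_)
open import Data.Maybe using (Maybe; just; nothing)
open import Data.Empty using (⊥)
open import Relation.Nullary using (¬_; yes; no)
open import Relation.Binary.PropositionalEquality using (_≡_; refl)

record Graph : Set where
  field
    size  : ℕ
    adj   : Fin size → Fin size → Bool
    sym   : ∀ u v → adj u v ≡ adj v u
    irrefl : ∀ u → adj u u ≡ false
open Graph public

data Player : Set where
  A B : Player

-- A position: a finite simple graph and, for each vertex, who claimed it
-- (nothing = unclaimed).  V_A and V_B are disjoint by construction.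
record Position : Set where
  field
    graph : Graph
    owner : Fin (size graph) → Maybe Player
open Position public

Dominates : (G : Graph) → (Fin (size G) → Maybe Player) → Player → Set
Dominates G s p =
  ∀ u → (s u ≡ just p) ⊎ Σ (Fin (size G)) (λ w → (adj G u w ≡ true) × (s w ≡ just p))

claim : ∀ {n} → (Fin n → Maybe Player) → Fin n → Player → Fin n → Maybe Player
claim s v p u with u ≟ v
... | yes _ = just p
... | no  _ = s u

-- AliceWins G k s t : with player t to move in state s, Alice can force that
-- her claimed vertices dominate G strictly before Bob's do, within at most
-- k further moves (k is a fuel bounding the game length; the number of
-- vertices always suffices since every move claims a new vertex).
-- If Bob's vertices already dominate, Alice has not won; otherwise if
-- Alice's vertices dominate she has won; otherwise the game continues, and
-- when no unclaimed vertex is left it is a draw.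
mutual
  AliceWins : (G : Graph) → ℕ → (Fin (size G) → Maybe Player) → Player → Set
  AliceWins G k s t = (¬ Dominates G s B) × (Dominates G s A ⊎ Continue G k s t)

  Continue : (G : Graph) → ℕ → (Fin (size G) → Maybe Player) → Player → Set
  Continue G zero    s t = ⊥
  Continue G (suc k) s A =
    Σ (Fin (size G)) λ v → (s v ≡ nothing) × AliceWins G k (claim s v A) B
  Continue G (suc k) s B =
    (Σ (Fin (size G)) λ v → s v ≡ nothing) ×
    (∀ v → s v ≡ nothing → AliceWins G k (claim s v B) A)

-- o(P,t) = 𝒜 iff Alice has a winning strategy with t to move.
AliceWinsFrom : Position → Player → Set
AliceWinsFrom P t = AliceWins (graph P) (size (graph P)) (owner P) t

-- o(P, t) = 𝒟 is expressed as ¬ AliceWinsFrom P t (o takes only values 𝒜, 𝒟).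

unionAdj : ∀ m k → (Fin m → Fin m → Bool) → (Fin k → Fin k → Bool)
         → Fin (m + k) → Fin (m + k) → Bool
unionAdj m k a b u v with splitAt m u | splitAt m v
... | inj₁ x | inj₁ y = a x y
... | inj₂ x | inj₂ y = b x y
... | inj₁ _ | inj₂ _ = false
... | inj₂ _ | inj₁ _ = false

unionSym : ∀ m k a b → (∀ x y → a x y ≡ a y x) → (∀ x y → b x y ≡ b y x)
         → ∀ u v → unionAdj m k a b u v ≡ unionAdj m k a b v u
unionSym m k a b sa sb u v with splitAt m u | splitAt m v
... | inj₁ x | inj₁ y = sa x y
... | inj₂ x | inj₂ y = sb x y
... | inj₁ _ | inj₂ _ = refl
... | inj₂ _ | inj₁ _ = refl

unionIrr : ∀ m k a b → (∀ x → a x x ≡ false) → (∀ x → b x x ≡ false)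
         → ∀ u → unionAdj m k a b u u ≡ false
unionIrr m k a b ia ib u with splitAt m u
... | inj₁ x = ia x
... | inj₂ x = ib x

_⊕G_ : Graph → Graph → Graph
G ⊕G H = record
  { size = size G + size H
  ; adj = unionAdj (size G) (size H) (adj G) (adj H)
  ; sym = unionSym (size G) (size H) (adj G) (adj H) (sym G) (sym H)
  ; irrefl = unionIrr (size G) (size H) (adj G) (adj H) (irrefl G) (irrefl H)
  }

unionOwner : ∀ m k → (Fin m → Maybe Player) → (Fin k → Maybe Player)
           → Fin (m + k) → Maybe Player
unionOwner m k s r u with splitAt m u
... | inj₁ x = s x
... | inj₂ y = r y

_∪P_ : Position → Position → Position
P ∪P Q = record
  { graph = graph P ⊕G graph Q
  ; owner = unionOwner (size (graph P)) (size (graph Q)) (owner P) (owner Q)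
  }

≡ᵇ-suc-irr : ∀ x → (suc x ≡ᵇ x) ≡ false
≡ᵇ-suc-irr zero    = refl
≡ᵇ-suc-irr (suc x) = ≡ᵇ-suc-irr x

pathAdj : ∀ m → Fin m → Fin m → Bool
pathAdj m i j = (suc (toℕ i) ≡ᵇ toℕ j) ∨ (suc (toℕ j) ≡ᵇ toℕ i)

pathGraph : ℕ → Graph
pathGraph m = record
  { size = m
  ; adj = pathAdj m
  ; sym = λ i j → ∨-comm (suc (toℕ i) ≡ᵇ toℕ j) (suc (toℕ j) ≡ᵇ toℕ i)
  ; irrefl = λ i → irr i
  }
  where
  irr : ∀ i → pathAdj m i i ≡ false
  irr i rewrite ≡ᵇ-suc-irr (toℕ i) = refl

other : Player → Player
other A = B
other B = A

-- The bounded path [X o^n Y] on v_{-1} v_0 v_1 … v_n v_{n+1} v_{n+2}: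
-- index i : Fin (n + 4) stands for vertex v_{i-1}.
boundedPathOwner : Player → ℕ → Player → ℕ → Maybe Player
boundedPathOwner X n Y zero          = just (other X)   -- v_{-1}
boundedPathOwner X n Y (suc zero)    = just X           -- v_0
boundedPathOwner X n Y (suc (suc i)) =
  if i Data.Nat.<ᵇ n then nothing                       -- v_1 … v_n
  else if i ≡ᵇ n then just Y                            -- v_{n+1}
  else just (other Y)                                   -- v_{n+2}

boundedPath : Player → ℕ → Player → Position
boundedPath X n Y = record
  { graph = pathGraph (n + 4)
  ; owner = λ i → boundedPathOwner X n Y (toℕ i)
  }

{-# OPTIONS --safe #-}
module Submission where

-- Bob moves first and keeps a free path vertex squeezed between two of his own.  If n = 1 he
-- claims v₁, which Alice can then never dominate.  Otherwise he claims v₂: now v₁ is free with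
-- both neighbours Bob's, so Alice must take v₁ at once (else Bob claims it), after which
-- v₂ v₃ … v_{n+1} is a copy of [B o^{n-2} B] with Bob to move.

open import Defs hiding (sym)
open import Data.Nat using (ℕ; _%_; _/_; zero; suc; _+_; _*_; _<_; _≤_; _<ᵇ_; _<?_; z≤n; s≤s)
open import Data.Nat.Properties
  using (≡ᵇ⇒≡; ≡⇒≡ᵇ; <ᵇ⇒<; <⇒<ᵇ; <-irrefl; ≤-refl; <⇒≤; +-cancelˡ-≡; suc-injective; +-comm; m≤n⇒m≤1+n)
open import Data.Nat.DivMod using (m≡m%n+[m/n]*n)
open import Data.Fin using (Fin; toℕ; fromℕ<; splitAt; _↑ʳ_; _≟_)
open import Data.Fin.Properties
  using (toℕ-fromℕ<; toℕ-injective; toℕ<n; ↑ʳ-injective; splitAt-↑ʳ; splitAt⁻¹-↑ʳ)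
open import Data.Bool using (true)
open import Data.Bool.Properties using (T-≡; T-∨; ¬-not)
open import Data.Sum using (_⊎_; inj₁; inj₂)
import Data.Sum as Sum
open import Data.Product using (Σ; _×_; _,_)
open import Data.Maybe using (Maybe; just; nothing)
open import Function.Bundles using (Equivalence)
open import Relation.Nullary using (¬_; yes; no; contradiction)
open import Relation.Binary.PropositionalEquality
  using (_≡_; _≢_; refl; sym; trans; cong; subst)

open Equivalence using (to; from)

State : Graph → Set
State G = Fin (size G) → Maybe Player

claim-self : ∀ {m} (s : Fin m → Maybe Player) v p → claim s v p v ≡ just p
claim-self s v p with v ≟ v
... | yes _   = refl
... | no v≢v = contradiction refl v≢v

claim-other : ∀ {m} (s : Fin m → Maybe Player) {u v} p → u ≢ v → claim s v p u ≡ s u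
claim-other s {u} {v} p u≢v with u ≟ v
... | yes u≡v = contradiction u≡v u≢v
... | no _    = refl

claim-preserves-owner : ∀ {m} (s : Fin m → Maybe Player) {u v q} p →
  s v ≡ nothing → s u ≡ just q → claim s v p u ≡ just q
claim-preserves-owner s {u} {v} p sv su with u ≟ v
... | yes refl = contradiction (trans (sym su) sv) λ ()
... | no u≢v   = su

just-B≢just-A : {x : Maybe Player} → x ≡ just B → x ≢ just A
just-B≢just-A refl ()

nothing≢just-A : {x : Maybe Player} → x ≡ nothing → x ≢ just A
nothing≢just-A refl ()

module _ (G : Graph) where

  private
    variable
      s : State G
      n : ℕ

  record SurroundedByBob (s : State G) (u : Fin (size G)) : Set where
    constructor surrounded
    field
      neighbour-of-Bob : ∀ w → adj G u w ≡ true → s w ≡ just B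
  open SurroundedByBob

  surrounded-claim : ∀ {u v} p → s v ≡ nothing → SurroundedByBob s u →
    SurroundedByBob (claim s v p) u
  surrounded-claim p sv surr =
    surrounded λ w uw → claim-preserves-owner _ {u = w} p sv (neighbour-of-Bob surr w uw)

  ¬Dominates-at : ∀ u → s u ≢ just A → (∀ w → adj G u w ≡ true → s w ≢ just A) →
    ¬ Dominates G s A
  ¬Dominates-at u su nb dom with dom u
  ... | inj₁ su≡A            = su su≡A
  ... | inj₂ (w , uw , sw≡A) = nb w uw sw≡A

  surrounded⇒¬Dominates : ∀ u → s u ≢ just A → SurroundedByBob s u → ¬ Dominates G s A
  surrounded⇒¬Dominates u su surr =
    ¬Dominates-at u su λ w uw → just-B≢just-A (neighbour-of-Bob surr w uw)

  AliceCannotWin : State G → Player → Set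
  AliceCannotWin s t = ∀ k → ¬ AliceWins G k s t

  bob-surrounded⇒AliceCannotWin : ∀ u → s u ≡ just B → SurroundedByBob s u →
    ∀ t → AliceCannotWin s t
  bob-surrounded⇒AliceCannotWin u su surr t k (_ , inj₁ dom) =
    surrounded⇒¬Dominates u (just-B≢just-A su) surr dom
  bob-surrounded⇒AliceCannotWin u su surr t zero (_ , inj₂ ())
  bob-surrounded⇒AliceCannotWin u su surr A (suc k) (_ , inj₂ (v , sv , win)) =
    bob-surrounded⇒AliceCannotWin u (claim-preserves-owner _ {u = u} A sv su)
      (surrounded-claim A sv surr) B k win
  bob-surrounded⇒AliceCannotWin u su surr B (suc k) (_ , inj₂ ((v , sv) , replies)) =
    bob-surrounded⇒AliceCannotWin u (claim-preserves-owner _ {u = u} B sv su)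
      (surrounded-claim B sv surr) A k (replies v sv)

  bob-moves : ∀ {v} → ¬ Dominates G s A → s v ≡ nothing →
    AliceCannotWin (claim s v B) A → AliceCannotWin s B
  bob-moves ¬dom sv cannot k       (_ , inj₁ dom)          = ¬dom dom
  bob-moves ¬dom sv cannot zero    (_ , inj₂ ())
  bob-moves ¬dom sv cannot (suc k) (_ , inj₂ (_ , replies)) = cannot k (replies _ sv)

  free-surrounded⇒AliceCannotWin : ∀ u → s u ≡ nothing → SurroundedByBob s u →
    AliceCannotWin s B
  free-surrounded⇒AliceCannotWin {s} u su surr =
    bob-moves (surrounded⇒¬Dominates u (nothing≢just-A su) surr) su
      (bob-surrounded⇒AliceCannotWin u (claim-self s u B) (surrounded-claim B su surr) A)

  alice-forced : ∀ u → s u ≡ nothing → SurroundedByBob s u →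
    AliceCannotWin (claim s u A) B → AliceCannotWin s A
  alice-forced u su surr cannot k (_ , inj₁ dom) =
    surrounded⇒¬Dominates u (nothing≢just-A su) surr dom
  alice-forced u su surr cannot zero (_ , inj₂ ())
  alice-forced {s} u su surr cannot (suc k) (_ , inj₂ (v , sv , win)) with v ≟ u
  ... | yes refl = cannot k win
  ... | no v≢u   =
    free-surrounded⇒AliceCannotWin u (trans (claim-other s A (λ u≡v → v≢u (sym u≡v))) su)
      (surrounded-claim A sv surr) k win

  -- A copy of [B o^n B] inside G: vertex 0 … vertex (suc n) play the role of v₀ … v_{n+1}.
  record Corridor (s : State G) (n : ℕ) : Set where
    field
      vertex     : ℕ → Fin (size G)
      injective  : ∀ {i j} → i ≤ suc n → j ≤ suc n → vertex i ≡ vertex j → i ≡ j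
      inner-adj  : ∀ {i w} → i < n → adj G (vertex (suc i)) w ≡ true →
                   w ≡ vertex i ⊎ w ≡ vertex (2 + i)
      left-end   : s (vertex 0) ≡ just B
      inner-free : ∀ {i} → i < n → s (vertex (suc i)) ≡ nothing
      right-end  : s (vertex (suc n)) ≡ just B

    distinct : ∀ {i j} → i ≤ suc n → j ≤ suc n → i ≢ j → vertex i ≢ vertex j
    distinct hi hj i≢j e = i≢j (injective hi hj e)

  corridor-advance : (c : Corridor s (2 + n)) → let open Corridor c in
    Corridor (claim (claim s (vertex 2) B) (vertex 1) A) n
  corridor-advance {s} {n} c = record
    { vertex     = λ i → vertex (2 + i)
    ; injective  = λ hi hj e → +-cancelˡ-≡ 2 _ _ (injective (s≤s (s≤s hi)) (s≤s (s≤s hj)) e)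
    ; inner-adj  = λ hi → inner-adj (s≤s (s≤s hi))
    ; left-end   = trans (claim-other _ A (distinct 2≤ 1≤ λ ())) (claim-self s (vertex 2) B)
    ; inner-free = λ hi → trans (untouched (s≤s (s≤s (s≤s (<⇒≤ hi)))) (λ ()) (λ ()))
                                (inner-free (s≤s (s≤s hi)))
    ; right-end  = trans (untouched ≤-refl (λ ()) (λ ())) right-end
    }
    where
    open Corridor c
    1≤ : 1 ≤ 3 + n
    1≤ = s≤s z≤n
    2≤ : 2 ≤ 3 + n
    2≤ = s≤s (s≤s z≤n)
    untouched : ∀ {i} → i ≤ 3 + n → i ≢ 1 → i ≢ 2 →
      claim (claim s (vertex 2) B) (vertex 1) A (vertex i) ≡ s (vertex i)
    untouched hi i≢1 i≢2 =
      trans (claim-other _ A (distinct hi 1≤ i≢1)) (claim-other s B (distinct hi 2≤ i≢2))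

  odd-corridor⇒AliceCannotWin : ∀ q → Corridor s (suc (q * 2)) → AliceCannotWin s B
  odd-corridor⇒AliceCannotWin {s} zero c =
    free-surrounded⇒AliceCannotWin (vertex 1) (inner-free (s≤s z≤n)) (surrounded ends-Bob)
    where
    open Corridor c
    ends-Bob : ∀ w → adj G (vertex 1) w ≡ true → s w ≡ just B
    ends-Bob w v₁w with inner-adj (s≤s z≤n) v₁w
    ... | inj₁ refl = left-end
    ... | inj₂ refl = right-end
  odd-corridor⇒AliceCannotWin {s} (suc q) c =
    bob-moves ¬dom (inner-free 1<) (alice-forced (vertex 1) v₁-free v₁-surrounded
      (odd-corridor⇒AliceCannotWin q (corridor-advance c)))
    where
    open Corridor c
    0< : 0 < 3 + q * 2
    0< = s≤s z≤n
    1< : 1 < 3 + q * 2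
    1< = s≤s (s≤s z≤n)
    ¬dom : ¬ Dominates G s A
    ¬dom = ¬Dominates-at (vertex 1) (nothing≢just-A (inner-free 0<)) neighbours-not-Alice
      where
      neighbours-not-Alice : ∀ w → adj G (vertex 1) w ≡ true → s w ≢ just A
      neighbours-not-Alice w v₁w with inner-adj 0< v₁w
      ... | inj₁ refl = just-B≢just-A left-end
      ... | inj₂ refl = nothing≢just-A (inner-free 1<)
    v₁-free : claim s (vertex 2) B (vertex 1) ≡ nothing
    v₁-free = trans (claim-other s B (distinct (s≤s z≤n) (s≤s (s≤s z≤n)) λ ())) (inner-free 0<)
    v₁-surrounded : SurroundedByBob (claim s (vertex 2) B) (vertex 1)
    v₁-surrounded = surrounded neighbours-Bob
      where
      neighbours-Bob : ∀ w → adj G (vertex 1) w ≡ true → claim s (vertex 2) B w ≡ just B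
      neighbours-Bob w v₁w with inner-adj 0< v₁w
      ... | inj₁ refl = claim-preserves-owner s B (inner-free 1<) left-end
      ... | inj₂ refl = claim-self s (vertex 2) B

unionOwner-↑ʳ : ∀ m k (s : Fin m → Maybe Player) (r : Fin k → Maybe Player) x →
  unionOwner m k s r (m ↑ʳ x) ≡ r x
unionOwner-↑ʳ m k s r x rewrite splitAt-↑ʳ m k x = refl

unionAdj-↑ʳ : ∀ m k a b (x : Fin k) w → unionAdj m k a b (m ↑ʳ x) w ≡ true →
  Σ (Fin k) λ y → m ↑ʳ y ≡ w × b x y ≡ true
unionAdj-↑ʳ m k a b x w xw rewrite splitAt-↑ʳ m k x with splitAt m w in split-w
... | inj₁ _ = contradiction xw λ ()
... | inj₂ y = y , splitAt⁻¹-↑ʳ split-w , xw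

↑ʳ-corridor : ∀ P Q {n} → Corridor (graph Q) (owner Q) n →
  Corridor (graph (P ∪P Q)) (owner (P ∪P Q)) n
↑ʳ-corridor P Q {n} c = record
  { vertex     = λ i → m ↑ʳ vertex i
  ; injective  = λ hi hj e → injective hi hj (↑ʳ-injective m _ _ e)
  ; inner-adj  = inner-adj′
  ; left-end   = trans (unionOwner-↑ʳ m k (owner P) (owner Q) _) left-end
  ; inner-free = λ hi → trans (unionOwner-↑ʳ m k (owner P) (owner Q) _) (inner-free hi)
  ; right-end  = trans (unionOwner-↑ʳ m k (owner P) (owner Q) _) right-end
  }
  where
  open Corridor c
  m = size (graph P)
  k = size (graph Q)
  inner-adj′ : ∀ {i w} → i < n → adj (graph (P ∪P Q)) (m ↑ʳ vertex (suc i)) w ≡ true →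
    w ≡ m ↑ʳ vertex i ⊎ w ≡ m ↑ʳ vertex (2 + i)
  inner-adj′ {i} {w} hi xw
    with unionAdj-↑ʳ m k (adj (graph P)) (adj (graph Q)) (vertex (suc i)) w xw
  ... | y , refl , xy = Sum.map (cong (m ↑ʳ_)) (cong (m ↑ʳ_)) (inner-adj hi xy)

-- Indices beyond the path are sent to an arbitrary vertex; only indices below m + 4 are used.
pathVertex : ∀ m → ℕ → Fin (m + 4)
pathVertex m i with i <? m + 4
... | yes i<m+4 = fromℕ< i<m+4
... | no _      = m ↑ʳ Data.Fin.zero

toℕ-pathVertex : ∀ {m i} → i < m + 4 → toℕ (pathVertex m i) ≡ i
toℕ-pathVertex {m} {i} i<m+4 with i <? m + 4
... | yes _     = toℕ-fromℕ< _
... | no i≮m+4 = contradiction i<m+4 i≮m+4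

pathVertex-toℕ : ∀ {m} (w : Fin (m + 4)) → pathVertex m (toℕ w) ≡ w
pathVertex-toℕ w = toℕ-injective (toℕ-pathVertex (toℕ<n w))

pathAdj⇒consecutive : ∀ k (x y : Fin k) → pathAdj k x y ≡ true →
  suc (toℕ x) ≡ toℕ y ⊎ suc (toℕ y) ≡ toℕ x
pathAdj⇒consecutive k x y xy =
  Sum.map (≡ᵇ⇒≡ _ _) (≡ᵇ⇒≡ _ _) (to T-∨ (from T-≡ xy))

boundedPathOwner-inner : ∀ X Y {i n} → i < n → boundedPathOwner X n Y (2 + i) ≡ nothing
boundedPathOwner-inner X Y i<n rewrite to T-≡ (<⇒<ᵇ i<n) = refl

boundedPathOwner-right : ∀ X n Y → boundedPathOwner X n Y (2 + n) ≡ just Y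
boundedPathOwner-right X n Y
  rewrite ¬-not {n <ᵇ n} {true} (λ n<ᵇn → <-irrefl refl (<ᵇ⇒< n n (from T-≡ n<ᵇn)))
        | to T-≡ (≡⇒≡ᵇ n n refl) = refl

boundedPath-corridor : ∀ n → Corridor (graph (boundedPath B n B)) (owner (boundedPath B n B)) n
boundedPath-corridor n = record
  { vertex     = vertex
  ; injective  = λ hi hj e →
      suc-injective (trans (sym (toℕ-vertex hi)) (trans (cong toℕ e) (toℕ-vertex hj)))
  ; inner-adj  = inner-adj
  ; left-end   = owner-vertex z≤n
  ; inner-free = λ hi → trans (owner-vertex (s≤s (<⇒≤ hi))) (boundedPathOwner-inner B B hi)
  ; right-end  = trans (owner-vertex ≤-refl) (boundedPathOwner-right B n B)
  }
  where
  vertex : ℕ → Fin (n + 4)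
  vertex i = pathVertex n (suc i)
  toℕ-vertex : ∀ {i} → i ≤ suc n → toℕ (vertex i) ≡ suc i
  toℕ-vertex {i} hi = toℕ-pathVertex (subst (2 + i ≤_) (+-comm 4 n) (m≤n⇒m≤1+n (s≤s (s≤s hi))))
  owner-vertex : ∀ {i} → i ≤ suc n →
    owner (boundedPath B n B) (vertex i) ≡ boundedPathOwner B n B (suc i)
  owner-vertex hi = cong (boundedPathOwner B n B) (toℕ-vertex hi)
  at-index : ∀ {w j} → toℕ w ≡ suc j → w ≡ vertex j
  at-index {w} e = trans (sym (pathVertex-toℕ w)) (cong (pathVertex n) e)
  inner-adj : ∀ {i w} → i < n → pathAdj (n + 4) (vertex (suc i)) w ≡ true →
    w ≡ vertex i ⊎ w ≡ vertex (2 + i)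
  inner-adj {i} {w} hi xw with pathAdj⇒consecutive (n + 4) (vertex (suc i)) w xw
  ... | inj₁ e = inj₂ (at-index (trans (sym e) (cong suc (toℕ-vertex (m≤n⇒m≤1+n hi)))))
  ... | inj₂ e = inj₁ (at-index (suc-injective (trans e (toℕ-vertex (m≤n⇒m≤1+n hi)))))

odd⇒≡1+[n/2]*2 : ∀ {n} → n % 2 ≡ 1 → n ≡ suc (n / 2 * 2)
odd⇒≡1+[n/2]*2 {n} n%2≡1 = trans (m≡m%n+[m/n]*n n 2) (cong (_+ n / 2 * 2) n%2≡1)

lemma13 : (P : Position) (n : ℕ) → n % 2 ≡ 1 →
    ¬ AliceWinsFrom (P ∪P boundedPath B n B) B
lemma13 P n n%2≡1 =
  odd-corridor⇒AliceCannotWin G (n / 2)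
    (subst (Corridor G (owner P∪path)) (odd⇒≡1+[n/2]*2 n%2≡1)
      (↑ʳ-corridor P (boundedPath B n B) (boundedPath-corridor n)))
    (size G)
  where
  P∪path = P ∪P boundedPath B n B
  G = graph P∪path
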